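{- Let $G$ be a connected graph and $I$ a set of integers such that, for every $l\in I$, every edge of $G$ lies on a cycle of length $l$. Then every edge of the Cartesian product $K_2\times G$ lies on a cycle of length $l'$ for every $l'\in \{l+2 \mid l\in I\}\cup\{l_1+l_2 \mid l_1,l_2\in I\}$.
   Context: Cycles have length at least $3$. The Cartesian product $K_2\times G$ is obtained from two copies $0G$ and $1G$ of $G$ by joining $0u$ and $1u$ for every $u\in V(G)$. -}

module Defs where

open import Data.Nat using (ℕ; zero; suc; _+_)
open import Data.Integer using (ℤ; +_)
open import Data.Fin using (Fin; zero; suc; inject₁; fromℕ)
open import Data.Bool using (Bool)
open import Data.Product using (Σ; ∃; ∃-syntax; _×_; _,_)
open import Data.Sum using (_⊎_)
open import Relation.Nullary using (¬_)
open import Relation.Binary.PropositionalEquality using (_≡_; _≢_)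
open import Relation.Binary.Construct.Closure.ReflexiveTransitive using (Star)
open import Function.Definitions using (Injective)

record Graph (n : ℕ) : Set₁ where
  field
    Adj     : Fin n → Fin n → Set
    symm    : ∀ {u v} → Adj u v → Adj v u
    irrefl  : ∀ {u} → ¬ Adj u u
open Graph public

Connected : ∀ {n} → Graph n → Set
Connected {n} G = ∀ (u v : Fin n) → Star (Adj G) u v

-- Cyclic sequences of 3 + m vertices f 0, f 1, ..., f (2+m).
-- x , y is a consecutive pair (in this orientation) of the cyclic sequence f.
Consec : ∀ {A : Set} (m : ℕ) → (Fin (suc (suc (suc m))) → A) → A → A → Set
Consec m f x y =
  (∃[ i ] (f (inject₁ i) ≡ x × f (suc i) ≡ y))
  ⊎ (f (fromℕ (suc (suc m))) ≡ x × f zero ≡ y)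

IsCycle : ∀ {A : Set} (R : A → A → Set) (m : ℕ) → (Fin (suc (suc (suc m))) → A) → Set
IsCycle R m f = Injective _≡_ _≡_ f × (∀ x y → Consec m f x y → R x y)

EdgeOnCycleOfLength : ∀ {A : Set} (R : A → A → Set) → A → A → ℕ → Set
EdgeOnCycleOfLength {A} R u v l =
  Σ ℕ λ m → l ≡ 3 + m × Σ (Fin (3 + m) → A) λ f →
    IsCycle R m f × (Consec m f u v ⊎ Consec m f v u)

EdgeOnCycleOfLengthℤ : ∀ {A : Set} (R : A → A → Set) → A → A → ℤ → Set
EdgeOnCycleOfLengthℤ R u v l = Σ ℕ λ k → l ≡ + k × EdgeOnCycleOfLength R u v k

EveryEdgeOnCycleOfLength : ∀ {A : Set} (R : A → A → Set) → ℤ → Set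
EveryEdgeOnCycleOfLength R l = ∀ u v → R u v → EdgeOnCycleOfLengthℤ R u v l

K2×Adj : ∀ {n} → Graph n → Bool × Fin n → Bool × Fin n → Set
K2×Adj G (a , u) (b , v) = (a ≡ b × Adj G u v) ⊎ (a ≢ b × u ≡ v)

module Submission where

-- An edge uv lies on a cycle of length l exactly when it is closed by a
-- simple walk v ⇝ u of length l - 1, the rest of the cycle.
-- A single edge is a closing walk of length 1, so l₂ = 2 gives l + 2.

open import Defs
open import Data.Nat using (ℕ; _≤_)
open import Data.Integer using (ℤ; _+_; +_)
open import Data.Product using (Σ; _×_)
open import Data.Sum using (_⊎_)
open import Relation.Binary.PropositionalEquality using (_≡_)

open import Data.Nat using (zero; suc; s≤s) renaming (_+_ to _+ℕ_)
open import Data.Nat.Properties using (+-suc)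
open import Data.Nat.Tactic.RingSolver using (solve-∀)
open import Data.Fin using (Fin; zero; suc; inject₁; fromℕ; toℕ)
open import Data.Bool using (Bool; not)
open import Data.Bool.Properties using (not-¬)
open import Data.Product using (∃; _,_; proj₁; proj₂)
open import Data.Sum using (inj₁; inj₂)
open import Data.Empty using (⊥; ⊥-elim)
open import Data.List using (List; []; _∷_; [_]; _++_; map; tabulate; reverse)
open import Data.List.Properties using (unfold-reverse)
open import Data.List.Membership.Propositional using (_∈_; _∉_)
open import Data.List.Membership.Propositional.Properties using (∈-map⁻; ∈-++⁻)
open import Data.List.Relation.Unary.Any using (here; there)
open import Data.List.Relation.Unary.All using ([]; _∷_)
open import Data.List.Relation.Unary.AllPairs using ([]; _∷_)
open import Data.List.Relation.Unary.All.Properties using (¬Any⇒All¬)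
open import Data.List.Relation.Unary.Unique.Propositional using (Unique)
open import Data.List.Relation.Unary.Unique.Propositional.Properties
  using (++⁺; map⁺; tabulate⁺; Unique[x∷xs]⇒x∉xs)
open import Data.List.Relation.Binary.Disjoint.Propositional using (Disjoint)
open import Data.List.Relation.Binary.Permutation.Propositional using (↭-sym; ↭⇒↭ₛ)
open import Data.List.Relation.Binary.Permutation.Propositional.Properties using (↭-reverse)
import Data.List.Relation.Binary.Permutation.Setoid.Properties as PermutationSetoid
open import Relation.Nullary using (¬_)
open import Relation.Binary.PropositionalEquality
  using (refl; sym; cong; subst; _≢_; setoid; module ≡-Reasoning)
open import Relation.Binary.Construct.Closure.ReflexiveTransitive using (Star; ε; _◅_)
open import Function.Definitions using (Injective)

data Walk {A : Set} (R : A → A → Set) : A → A → ℕ → Set where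
  end    : ∀ x → Walk R x x zero
  _∷⟨_⟩_ : ∀ x {y z k} → R x y → Walk R y z k → Walk R x z (suc k)

module _ {A : Set} {R : A → A → Set} where

  vertices : ∀ {x y k} → Walk R x y k → List A
  vertices (end x)      = [ x ]
  vertices (x ∷⟨ _ ⟩ p) = x ∷ vertices p

  Simple : ∀ {x y k} → Walk R x y k → Set
  Simple p = Unique (vertices p)

  join : ∀ {x y z w i j} → Walk R x y i → R y z → Walk R z w j → Walk R x w (suc (i +ℕ j))
  join (end x)      e q = x ∷⟨ e ⟩ q
  join (x ∷⟨ f ⟩ p) e q = x ∷⟨ f ⟩ join p e q

  vertices-join : ∀ {x y z w i j} (p : Walk R x y i) (e : R y z) (q : Walk R z w j)
                  → vertices (join p e q) ≡ vertices p ++ vertices q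
  vertices-join (end x)      e q = refl
  vertices-join (x ∷⟨ _ ⟩ p) e q = cong (x ∷_) (vertices-join p e q)

  join-simple : ∀ {x y z w i j} (p : Walk R x y i) (e : R y z) (q : Walk R z w j)
                → Simple p → Simple q → Disjoint (vertices p) (vertices q) → Simple (join p e q)
  join-simple p e q sp sq disjoint =
    subst Unique (sym (vertices-join p e q)) (++⁺ sp sq disjoint)

  snoc : ∀ {x y z k} → Walk R x y k → R y z → Walk R x z (suc k)
  snoc (end x)      e = x ∷⟨ e ⟩ end _
  snoc (x ∷⟨ f ⟩ p) e = x ∷⟨ f ⟩ snoc p e

  vertices-snoc : ∀ {x y z k} (p : Walk R x y k) (e : R y z)
                  → vertices (snoc p e) ≡ vertices p ++ [ z ]
  vertices-snoc (end x)      e = refl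
  vertices-snoc (x ∷⟨ _ ⟩ p) e = cong (x ∷_) (vertices-snoc p e)

  snoc-simple : ∀ {x y z k} (p : Walk R x y k) (e : R y z)
                → Simple p → z ∉ vertices p → Simple (snoc p e)
  snoc-simple p e sp z∉p = subst Unique (sym (vertices-snoc p e))
    (++⁺ sp ([] ∷ []) λ { (z∈p , here refl) → z∉p z∈p })

  module Reverse (R-sym : ∀ {a b} → R a b → R b a) where

    reverseWalk : ∀ {x y k} → Walk R x y k → Walk R y x k
    reverseWalk (end x)      = end x
    reverseWalk (x ∷⟨ e ⟩ p) = snoc (reverseWalk p) (R-sym e)

    vertices-reverse : ∀ {x y k} (p : Walk R x y k)
                       → vertices (reverseWalk p) ≡ reverse (vertices p)
    vertices-reverse (end x)      = refl
    vertices-reverse (x ∷⟨ e ⟩ p) = begin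
      vertices (snoc (reverseWalk p) (R-sym e)) ≡⟨ vertices-snoc (reverseWalk p) (R-sym e) ⟩
      vertices (reverseWalk p) ++ [ x ]         ≡⟨ cong (_++ [ x ]) (vertices-reverse p) ⟩
      reverse (vertices p) ++ [ x ]             ≡⟨ unfold-reverse x (vertices p) ⟨
      reverse (x ∷ vertices p)                  ∎
      where open ≡-Reasoning

    -- A reversed simple walk is simple: its vertex list is a permutation.
    reverse-simple : ∀ {x y k} (p : Walk R x y k) → Simple p → Simple (reverseWalk p)
    reverse-simple p sp = subst Unique (sym (vertices-reverse p))
      (PermutationSetoid.Unique-resp-↭ (setoid A) (↭⇒↭ₛ (↭-sym (↭-reverse (vertices p)))) sp)

module _ {A B : Set} {R : A → A → Set} {S : B → B → Set}
         (f : A → B) (f-hom : ∀ {x y} → R x y → S (f x) (f y)) where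

  mapWalk : ∀ {x y k} → Walk R x y k → Walk S (f x) (f y) k
  mapWalk (end x)      = end (f x)
  mapWalk (x ∷⟨ e ⟩ p) = f x ∷⟨ f-hom e ⟩ mapWalk p

  vertices-map : ∀ {x y k} (p : Walk R x y k) → vertices (mapWalk p) ≡ map f (vertices p)
  vertices-map (end x)      = refl
  vertices-map (x ∷⟨ _ ⟩ p) = cong (f x ∷_) (vertices-map p)

  map-simple : Injective _≡_ _≡_ f → ∀ {x y k} (p : Walk R x y k) → Simple p → Simple (mapWalk p)
  map-simple f-inj p sp = subst Unique (sym (vertices-map p)) (map⁺ f-inj sp)

module _ {A : Set} {R : A → A → Set} where

  vertexAt : ∀ {x y k} → Walk R x y k → Fin (suc k) → A
  vertexAt (end x)      zero    = x
  vertexAt (x ∷⟨ _ ⟩ p) zero    = x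
  vertexAt (x ∷⟨ _ ⟩ p) (suc i) = vertexAt p i

  vertexAt-first : ∀ {x y k} (p : Walk R x y k) → vertexAt p zero ≡ x
  vertexAt-first (end x)      = refl
  vertexAt-first (x ∷⟨ _ ⟩ p) = refl

  vertexAt-last : ∀ {x y k} (p : Walk R x y k) → vertexAt p (fromℕ k) ≡ y
  vertexAt-last (end x)      = refl
  vertexAt-last (x ∷⟨ _ ⟩ p) = vertexAt-last p

  vertexAt-step : ∀ {x y k} (p : Walk R x y k) (i : Fin k)
                  → R (vertexAt p (inject₁ i)) (vertexAt p (suc i))
  vertexAt-step (x ∷⟨ e ⟩ p) zero    = subst (R x) (sym (vertexAt-first p)) e
  vertexAt-step (x ∷⟨ _ ⟩ p) (suc i) = vertexAt-step p i

  vertexAt-∈ : ∀ {x y k} (p : Walk R x y k) (i : Fin (suc k)) → vertexAt p i ∈ vertices p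
  vertexAt-∈ (end x)      zero    = here refl
  vertexAt-∈ (x ∷⟨ _ ⟩ p) zero    = here refl
  vertexAt-∈ (x ∷⟨ _ ⟩ p) (suc i) = there (vertexAt-∈ p i)

  vertexAt-injective : ∀ {x y k} (p : Walk R x y k) → Simple p → Injective _≡_ _≡_ (vertexAt p)
  vertexAt-injective (end x)      _        {zero}  {zero}  _  = refl
  vertexAt-injective (x ∷⟨ _ ⟩ p) _        {zero}  {zero}  _  = refl
  vertexAt-injective (x ∷⟨ _ ⟩ p) sp       {zero}  {suc j} eq =
    ⊥-elim (Unique[x∷xs]⇒x∉xs sp (subst (_∈ vertices p) (sym eq) (vertexAt-∈ p j)))
  vertexAt-injective (x ∷⟨ _ ⟩ p) sp       {suc i} {zero}  eq =
    ⊥-elim (Unique[x∷xs]⇒x∉xs sp (subst (_∈ vertices p) eq (vertexAt-∈ p i)))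
  vertexAt-injective (x ∷⟨ _ ⟩ p) (_ ∷ sp) {suc i} {suc j} eq =
    cong suc (vertexAt-injective p sp eq)

  closeWalk : ∀ {x y m} (p : Walk R y x (2 +ℕ m)) → Simple p → R x y
              → EdgeOnCycleOfLength R x y (3 +ℕ m)
  closeWalk {x} {y} {m} p sp e =
    m , refl , vertexAt p , (vertexAt-injective p sp , adjacent) ,
    inj₁ (inj₂ (vertexAt-last p , vertexAt-first p))
    where
    adjacent : ∀ a b → Consec m (vertexAt p) a b → R a b
    adjacent _ _ (inj₁ (i , refl , refl)) = vertexAt-step p i
    adjacent _ _ (inj₂ (refl , refl))     =
      subst (λ z → R z (vertexAt p zero)) (sym (vertexAt-last p))
        (subst (R x) (sym (vertexAt-first p)) e)

  walkOf : ∀ {k} (f : Fin (suc k) → A) → (∀ i → R (f (inject₁ i)) (f (suc i)))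
           → Walk R (f zero) (f (fromℕ k)) k
  walkOf {zero}  f step = end (f zero)
  walkOf {suc k} f step = f zero ∷⟨ step zero ⟩ walkOf (λ i → f (suc i)) (λ i → step (suc i))

  vertices-walkOf : ∀ {k} (f : Fin (suc k) → A) step → vertices (walkOf f step) ≡ tabulate f
  vertices-walkOf {zero}  f step = refl
  vertices-walkOf {suc k} f step = cong (f zero ∷_) (vertices-walkOf (λ i → f (suc i)) (λ i → step (suc i)))

  walkOf-simple : ∀ {k} (f : Fin (suc k) → A) step → Injective _≡_ _≡_ f → Simple (walkOf f step)
  walkOf-simple f step f-inj = subst Unique (sym (vertices-walkOf f step)) (tabulate⁺ f-inj)

  StepAt : ∀ {x y k} → Walk R x y k → ℕ → A → A → Set
  StepAt (end _)                _       _ _ = ⊥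
  StepAt (_∷⟨_⟩_ x {y} _ _)     zero    u v = x ≡ u × y ≡ v
  StepAt (x ∷⟨ _ ⟩ p)           (suc n) u v = StepAt p n u v

  StepAt-walkOf : ∀ {k} (f : Fin (suc (suc k)) → A) step (i : Fin (suc k))
                  → StepAt (walkOf f step) (toℕ i) (f (inject₁ i)) (f (suc i))
  StepAt-walkOf f step zero           = refl , refl
  StepAt-walkOf {suc k} f step (suc i) =
    StepAt-walkOf (λ j → f (suc j)) (λ j → step (suc j)) i

  StepAt-snoc : ∀ {x y z k n u v} (p : Walk R x y k) (e : R y z)
                → StepAt p n u v → StepAt (snoc p e) n u v
  StepAt-snoc {n = zero}  (x ∷⟨ _ ⟩ end _)       e s = s
  StepAt-snoc {n = zero}  (x ∷⟨ _ ⟩ (_ ∷⟨ _ ⟩ _)) e s = s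
  StepAt-snoc {n = suc n} (x ∷⟨ _ ⟩ p)           e s = StepAt-snoc p e s

  -- For n > 0 the
  -- first edge of p is rotated to the closing position.
  openAt : ∀ n {x y k u v} (p : Walk R x y k) → Simple p → R y x → StepAt p n u v
           → Σ (Walk R v u k) Simple
  openAt zero    (x ∷⟨ _ ⟩ p) sp@(_ ∷ sp') closing (refl , refl) =
    snoc p closing , snoc-simple p closing sp' (Unique[x∷xs]⇒x∉xs sp)
  openAt (suc n) (x ∷⟨ e ⟩ p) sp@(_ ∷ sp') closing step =
    openAt n (snoc p closing) (snoc-simple p closing sp' (Unique[x∷xs]⇒x∉xs sp)) e
      (StepAt-snoc p closing step)

  cycleStep : ∀ {m f} → IsCycle R m f → ∀ i → R (f (inject₁ i)) (f (suc i))
  cycleStep (_ , adjacent) i = adjacent _ _ (inj₁ (i , refl , refl))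

  cycleClosing : ∀ {m f} → IsCycle R m f → R (f (fromℕ (2 +ℕ m))) (f zero)
  cycleClosing (_ , adjacent) = adjacent _ _ (inj₂ (refl , refl))

  cycleWalk : ∀ {m f} → IsCycle R m f → Σ (Walk R (f zero) (f (fromℕ (2 +ℕ m))) (2 +ℕ m)) Simple
  cycleWalk {f = f} cycle@(f-inj , _) =
    walkOf f (cycleStep cycle) , walkOf-simple f (cycleStep cycle) f-inj

  cycleRest : ∀ {m f a b} → IsCycle R m f → Consec m f a b → Σ (Walk R b a (2 +ℕ m)) Simple
  cycleRest {f = f} cycle (inj₁ (i , refl , refl)) =
    let (p , sp) = cycleWalk cycle
    in openAt (toℕ i) p sp (cycleClosing cycle) (StepAt-walkOf f (cycleStep cycle) i)
  cycleRest cycle (inj₂ (refl , refl)) = cycleWalk cycle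

  ClosingWalks : ℤ → Set
  ClosingWalks l = ∀ u v → R u v → Σ ℕ λ k → l ≡ + (2 +ℕ k) × Σ (Walk R v u (suc k)) Simple

  module _ (R-sym : ∀ {a b} → R a b → R b a) where
    open Reverse {R = R} R-sym

    cycles-closing : ∀ {l} → EveryEdgeOnCycleOfLength R l → ClosingWalks l
    cycles-closing onCycle u v e with onCycle u v e
    ... | _ , refl , m , refl , _ , cycle , inj₁ uv = suc m , refl , cycleRest cycle uv
    ... | _ , refl , m , refl , _ , cycle , inj₂ vu =
      let (p , sp) = cycleRest cycle vu in suc m , refl , reverseWalk p , reverse-simple p sp

    edges-closing : (∀ {a} → ¬ R a a) → ClosingWalks (+ 2)
    edges-closing R-irrefl u v e =
      zero , refl , v ∷⟨ R-sym e ⟩ end u , (v≢u ∷ []) ∷ [] ∷ []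
      where
      v≢u : v ≢ u
      v≢u refl = R-irrefl e

firstEdge : ∀ {A : Set} {R : A → A → Set} {u w} → Star R u w → u ≢ w → ∃ (R u)
firstEdge ε        u≢w = ⊥-elim (u≢w refl)
firstEdge (e ◅ _)  _   = _ , e

neighbour : ∀ {n} (G : Graph n) → 2 ≤ n → Connected G → ∀ u → ∃ (Adj G u)
neighbour G (s≤s (s≤s _)) connected zero    = firstEdge (connected zero (suc zero)) λ ()
neighbour G (s≤s (s≤s _)) connected (suc u) = firstEdge (connected (suc u) zero) λ ()

module Prism {n : ℕ} (G : Graph n) where

  _~_ : Bool × Fin n → Bool × Fin n → Set
  _~_ = K2×Adj G

  rung : ∀ {a b u} → a ≢ b → (a , u) ~ (b , u)
  rung a≢b = inj₂ (a≢b , refl)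

  a≢not-a : ∀ {a} → a ≢ not a
  a≢not-a = not-¬ refl

  not-a≢a : ∀ {a} → not a ≢ a
  not-a≢a eq = a≢not-a (sym eq)

  layer : ∀ a {x y k} → Walk (Adj G) x y k → Walk _~_ (a , x) (a , y) k
  layer a = mapWalk (a ,_) (λ e → inj₁ (refl , e))

  layer-simple : ∀ a {x y k} (p : Walk (Adj G) x y k) → Simple p → Simple (layer a p)
  layer-simple a = map-simple (a ,_) (λ e → inj₁ (refl , e)) (cong proj₂)

  ∈-layer : ∀ a {x y k} (p : Walk (Adj G) x y k) {c}
            → c ∈ vertices (layer a p) → ∃ λ w → w ∈ vertices p × c ≡ (a , w)
  ∈-layer a p c∈ = ∈-map⁻ (a ,_) (subst (_ ∈_) (vertices-map (a ,_) _ p) c∈)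

  layers-disjoint : ∀ {a b x y z w i j} → a ≢ b
                    → (p : Walk (Adj G) x y i) (q : Walk (Adj G) z w j)
                    → Disjoint (vertices (layer a p)) (vertices (layer b q))
  layers-disjoint a≢b p q (c∈p , c∈q) with ∈-layer _ p c∈p | ∈-layer _ q c∈q
  ... | _ , _ , refl | _ , _ , eq = a≢b (cong proj₁ eq)

  rungCycle : ∀ {a b u v p q} → a ≢ b
              → (P : Walk (Adj G) u v (suc p)) → Simple P
              → (Q : Walk (Adj G) v u q) → Simple Q
              → EdgeOnCycleOfLength _~_ (a , u) (b , u) (3 +ℕ (p +ℕ q))
  rungCycle {a} {b} a≢b P sP Q sQ =
    closeWalk (join (layer b P) (rung b≢a) (layer a Q))
      (join-simple (layer b P) _ (layer a Q) (layer-simple b P sP) (layer-simple a Q sQ)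
        (layers-disjoint b≢a P Q))
      (rung a≢b)
    where
    b≢a : b ≢ a
    b≢a = λ eq → a≢b (sym eq)

  -- The layer edge (a,u)(a,v) is closed by the walk that crosses at v,
  -- follows Q : v ⇝ w in the other layer, crosses back at w and returns
  -- along P' : w ⇝ u, which avoids v.
  layerCycle : ∀ a {u v w p q} → Adj G u v
               → (P' : Walk (Adj G) w u p) → Simple P' → v ∉ vertices P'
               → (Q : Walk (Adj G) v w (suc q)) → Simple Q
               → EdgeOnCycleOfLength _~_ (a , u) (a , v) (3 +ℕ suc (q +ℕ p))
  layerCycle a {v = v} e P' sP' v∉P' Q sQ =
    closeWalk ((a , v) ∷⟨ rung a≢not-a ⟩ W) (¬Any⇒All¬ _ start∉W ∷ simpleW) (inj₁ (refl , e))
    where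
    W = join (layer (not a) Q) (rung not-a≢a) (layer a P')
    simpleW : Simple W
    simpleW = join-simple (layer (not a) Q) _ (layer a P')
      (layer-simple (not a) Q sQ) (layer-simple a P' sP')
      (layers-disjoint not-a≢a Q P')
    start∉W : (a , v) ∉ vertices W
    start∉W av∈W with ∈-++⁻ (vertices (layer (not a) Q))
                        (subst (_ ∈_) (vertices-join (layer (not a) Q) _ (layer a P')) av∈W)
    ... | inj₁ av∈Q with ∈-layer (not a) Q av∈Q
    ...   | _ , _ , eq = a≢not-a (cong proj₁ eq)
    start∉W av∈W | inj₂ av∈P' with ∈-layer a P' av∈P'
    ...   | _ , v∈P' , refl = v∉P' v∈P'

  prismCycles : (∀ u → ∃ (Adj G u)) → ∀ {l₁ l₂}
                → ClosingWalks {R = Adj G} l₁ → ClosingWalks {R = Adj G} l₂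
                → EveryEdgeOnCycleOfLength _~_ (l₁ + l₂)
  prismCycles _ close₁ close₂ (a , u) (_ , v) (inj₁ (refl , e))
    with close₁ u v e
  ... | p , refl , (_ ∷⟨ e₁ ⟩ P') , sP@(_ ∷ sP') with close₂ _ v (symm G e₁)
  ... | q , refl , Q , sQ =
    _ , cong +_ (layerLength p q) , layerCycle a e P' sP' (Unique[x∷xs]⇒x∉xs sP) Q sQ
    where
    layerLength : ∀ p q → (2 +ℕ p) +ℕ (2 +ℕ q) ≡ 3 +ℕ suc (q +ℕ p)
    layerLength = solve-∀
  prismCycles hasNeighbour close₁ close₂ (a , u) (b , _) (inj₂ (a≢b , refl))
    with hasNeighbour u
  ... | v , e with close₁ v u (symm G e) | close₂ u v e
  ... | p , refl , P , sP | q , refl , Q , sQ =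
    _ , cong +_ (cong (2 +ℕ_) (+-suc p (suc q))) , rungCycle a≢b P sP Q sQ

lemma2 : ∀ {n : ℕ} (G : Graph n) → 2 ≤ n → Connected G → (I : ℤ → Set)
    → (∀ l → I l → EveryEdgeOnCycleOfLength (Adj G) l)
    → ∀ (l' : ℤ)
    → ((Σ ℤ λ l → I l × l' ≡ l + + 2)
    ⊎ (Σ ℤ λ l₁ → Σ ℤ λ l₂ → I l₁ × I l₂ × l' ≡ l₁ + l₂))
    → EveryEdgeOnCycleOfLength (K2×Adj G) l'
lemma2 G 2≤n connected I onCycles _ (inj₁ (l , l∈I , refl)) =
  prismCycles (neighbour G 2≤n connected)
    (cycles-closing (symm G) (onCycles l l∈I)) (edges-closing (symm G) (irrefl G))
  where open Prism G
lemma2 G 2≤n connected I onCycles _ (inj₂ (l₁ , l₂ , l₁∈I , l₂∈I , refl)) =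
  prismCycles (neighbour G 2≤n connected)
    (cycles-closing (symm G) (onCycles l₁ l₁∈I)) (cycles-closing (symm G) (onCycles l₂ l₂∈I))
  where open Prism G
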